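{- Fix a positive integer $n$. For every finite family $\mathcal F$ of finite sets and all real numbers $0<\lambda\le\mu$, $$c_\mu(\mathcal F)\le\left(\frac{\lambda}{\mu}\right)^{\tau(\mathcal F)}c_\lambda(\mathcal F).$$
   Context: A cover of a family $\mathcal F$ is a set meeting every member of $\mathcal F$; $\tau(\mathcal F)$ is the minimum size of a cover. A minimal cover is a cover none of whose proper subsets is a cover. With $n$ fixed, $\mathcal C(\mathcal F)$ is the family of all minimal covers $C$ of $\mathcal F$ with $|C|\le n$, and for $\lambda>0$, $c_\lambda(\mathcal F)=\sum_{C\in\mathcal C(\mathcal F)}\lambda^{ -|C|}$. -}

module Defs where

open import Level using (Level; _⊔_) renaming (suc to lsuc)
open import Data.Nat using (ℕ; zero; suc) renaming (_≤_ to _≤ℕ_; _≤?_ to _≤ℕ?_)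
open import Data.Bool using (true; false)
open import Data.Product using (_×_; _,_; ∃; proj₁; proj₂)
open import Data.List using (List; []; _∷_; _++_; map; foldr; filter)
open import Data.List.Relation.Unary.All using (All) renaming (all? to allL?)
open import Data.Vec using (Vec; []; _∷_)
open import Data.Fin using (Fin)
open import Data.Fin.Subset using (Subset; _∩_; Nonempty; _⊂_; _∈_; _∉_; ∣_∣)
open import Data.Fin.Subset.Properties using (nonempty?; anySubset?; _∈?_)
open import Data.Fin.Properties using (any?) renaming (all? to allF?)
open import Relation.Nullary using (¬_; Dec; yes; no)
open import Relation.Nullary.Decidable using (_×-dec_; ¬?; map′)
open import Relation.Binary using (Rel; IsTotalOrder)
open import Relation.Binary.PropositionalEquality using (_≡_)
open import Algebra.Bundles using (CommutativeRing)

-- Ordered fields (the reals are one).  Standard axioms: a commutative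
-- ring with a total order compatible with + and *, 0 ≠ 1, and
-- multiplicative inverses of nonzero elements.

record OrderedField (c ℓ₁ ℓ₂ : Level) : Set (lsuc (c ⊔ ℓ₁ ⊔ ℓ₂)) where
  field
    commutativeRing : CommutativeRing c ℓ₁
  open CommutativeRing commutativeRing public
  infix 4 _≤_ _<_
  field
    _≤_          : Rel Carrier ℓ₂
    isTotalOrder : IsTotalOrder _≈_ _≤_
    +-mono-≤     : ∀ {x y} z → x ≤ y → x + z ≤ y + z
    *-nonneg     : ∀ {x y} → 0# ≤ x → 0# ≤ y → 0# ≤ x * y
    0≉1          : ¬ (0# ≈ 1#)
    inv          : (x : Carrier) → ¬ (x ≈ 0#) → Carrier
    inverse      : ∀ x (p : ¬ (x ≈ 0#)) → x * inv x p ≈ 1#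

  _<_ : Rel Carrier (ℓ₁ ⊔ ℓ₂)
  x < y = x ≤ y × ¬ (x ≈ y)

  _^_ : Carrier → ℕ → Carrier
  x ^ zero  = 1#
  x ^ suc k = x * (x ^ k)

  pos⇒≉0 : ∀ {x} → 0# < x → ¬ (x ≈ 0#)
  pos⇒≉0 (_ , 0≉x) x≈0 = 0≉x (sym x≈0)

  _^-_[_] : (x : Carrier) → ℕ → 0# < x → Carrier
  x ^- k [ p ] = inv x (pos⇒≉0 p) ^ k

  _/_[_] : Carrier → (y : Carrier) → 0# < y → Carrier
  x / y [ p ] = x * inv y (pos⇒≉0 p)

  open IsTotalOrder isTotalOrder using (antisym; ≤-respʳ-≈) renaming (trans to ≤-trans)
    renaming (reflexive to ≤-reflexive)

  <-≤-pos : ∀ {x y} → 0# < x → x ≤ y → 0# < y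
  <-≤-pos (0≤x , 0≉x) x≤y =
    ≤-trans 0≤x x≤y , λ 0≈y → 0≉x (antisym 0≤x (≤-respʳ-≈ (sym 0≈y) x≤y))

module _ {m : ℕ} where

  Cover : List (Subset m) → Subset m → Set
  Cover ℱ C = All (λ A → Nonempty (A ∩ C)) ℱ

  MinimalCover : List (Subset m) → Subset m → Set
  MinimalCover ℱ C = Cover ℱ C × (∀ D → D ⊂ C → ¬ Cover ℱ D)

  IsTau : List (Subset m) → ℕ → Set
  IsTau ℱ t = (∃ λ C → Cover ℱ C × ∣ C ∣ ≡ t) × (∀ C → Cover ℱ C → t ≤ℕ ∣ C ∣)

  cover? : ∀ ℱ C → Dec (Cover ℱ C)
  cover? ℱ C = allL? (λ A → nonempty? (A ∩ C)) ℱ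

  ⊆? : ∀ (D C : Subset m) → Dec (∀ x → x ∈ D → x ∈ C)
  ⊆? D C = allF? λ x → dec→ (x ∈? D) (x ∈? C)
    where
    dec→ : ∀ {a b} {P : Set a} {Q : Set b} → Dec P → Dec Q → Dec (P → Q)
    dec→ _       (yes q) = yes λ _ → q
    dec→ (no ¬p) _       = yes λ p → Data.Empty.⊥-elim (¬p p)
      where import Data.Empty
    dec→ (yes p) (no ¬q) = no λ f → ¬q (f p)

  ⊂? : ∀ (D C : Subset m) → Dec (D ⊂ C)
  ⊂? D C = map′ (λ { (s , e) → (λ {x} → s x) , e }) (λ { (s , e) → (λ x → s {x}) , e })
             (⊆? D C ×-dec any? (λ x → (x ∈? C) ×-dec ¬? (x ∈? D)))

  minimalCover? : ∀ ℱ C → Dec (MinimalCover ℱ C)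
  minimalCover? ℱ C = cover? ℱ C ×-dec
    map′ (λ ¬∃ D D⊂C cD → ¬∃ (D , D⊂C , cD)) (λ ∀¬ (D , D⊂C , cD) → ∀¬ D D⊂C cD)
      (¬? (anySubset? (λ D → ⊂? D C ×-dec cover? ℱ D)))

  allSubsets : (k : ℕ) → List (Subset k)
  allSubsets zero    = [] ∷ []
  allSubsets (suc k) = map (true ∷_) (allSubsets k) ++ map (false ∷_) (allSubsets k)

  𝒞 : ℕ → List (Subset m) → List (Subset m)
  𝒞 n ℱ = filter (λ C → minimalCover? ℱ C ×-dec (∣ C ∣ ≤ℕ? n)) (allSubsets m)

module _ {c ℓ₁ ℓ₂} (K : OrderedField c ℓ₁ ℓ₂) where
  open OrderedField K

  cλ : ∀ {m} (n : ℕ) (ℱ : List (Subset m)) (λ' : Carrier) → 0# < λ' → Carrier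
  cλ n ℱ λ' p = foldr (λ C s → (λ' ^- ∣ C ∣ [ p ]) + s) 0# (𝒞 n ℱ)

{-# OPTIONS --safe #-}
-- Every C ∈ 𝒞(ℱ) is a cover, so |C| ≥ τ(ℱ). With r = λ/μ ∈ (0, 1] we have
-- μ^{-|C|} = r^{|C|} λ^{-|C|} ≤ r^{τ(ℱ)} λ^{-|C|}; summing over 𝒞(ℱ) gives the claim.
module Submission where

open import Defs
open import Data.Nat using (ℕ; NonZero; zero; suc)
import Data.Nat as ℕ
import Data.Nat.Properties as ℕ
open import Data.Empty using (⊥-elim)
open import Relation.Nullary using (¬_)
open import Data.Product using (_,_; proj₁)
open import Data.Sum using (inj₁; inj₂)
open import Data.List using (List; []; _∷_; foldr)
open import Data.List.Relation.Unary.All using (All; []; _∷_)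
import Data.List.Relation.Unary.All as All
open import Data.List.Relation.Unary.All.Properties using (all-filter)
open import Data.Fin.Subset using (Subset; ∣_∣)
open import Relation.Nullary.Decidable using (_×-dec_)
open import Relation.Binary.Structures using (IsTotalOrder)
import Algebra.Properties.Ring as RingProperties
import Algebra.Properties.CommutativeSemiring.Exp as Exp

module OrderedFieldProperties {c ℓ₁ ℓ₂} (K : OrderedField c ℓ₁ ℓ₂) where
  open OrderedField K
  open RingProperties ring using (-‿distribʳ-*; -1*x≈-x; -‿involutive; [y-z]x≈yx-zx)
  open Exp commutativeSemiring using (^-distrib-*; ^-congˡ) renaming (_^_ to _^ᵉ_)
  open IsTotalOrder isTotalOrder using (total; antisym)
    renaming (trans to ≤-trans; reflexive to ≤-reflexive; ≤-respˡ-≈ to ≤-respˡ; ≤-respʳ-≈ to ≤-respʳ)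
  open import Relation.Binary.Reasoning.Setoid setoid

  x≤y⇒0≤y-x : ∀ {x y} → x ≤ y → 0# ≤ y - x
  x≤y⇒0≤y-x {x} h = ≤-respˡ (-‿inverseʳ x) (+-mono-≤ (- x) h)

  0≤y-x⇒x≤y : ∀ {x y} → 0# ≤ y - x → x ≤ y
  0≤y-x⇒x≤y {x} {y} h = ≤-respˡ (+-identityˡ x) (≤-respʳ y-x+x≈y (+-mono-≤ x h))
    where
    y-x+x≈y : y - x + x ≈ y
    y-x+x≈y = begin
      y - x + x     ≈⟨ +-assoc y (- x) x ⟩
      y + (- x + x) ≈⟨ +-congˡ (-‿inverseˡ x) ⟩
      y + 0#        ≈⟨ +-identityʳ y ⟩
      y             ∎

  x≤0⇒0≤-x : ∀ {x} → x ≤ 0# → 0# ≤ - x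
  x≤0⇒0≤-x {x} h = ≤-respʳ (+-identityˡ (- x)) (x≤y⇒0≤y-x h)

  0≤-x⇒x≤0 : ∀ {x} → 0# ≤ - x → x ≤ 0#
  0≤-x⇒x≤0 {x} h = ≤-respʳ (-‿inverseˡ x) (≤-respˡ (+-identityˡ x) (+-mono-≤ x h))

  +-mono-≤₂ : ∀ {a b x y} → a ≤ b → x ≤ y → a + x ≤ b + y
  +-mono-≤₂ {a} {b} {x} {y} a≤b x≤y =
    ≤-trans (+-mono-≤ x a≤b) (≤-respˡ (+-comm x b) (≤-respʳ (+-comm y b) (+-mono-≤ b x≤y)))

  *-monoˡ-≤-nonNeg : ∀ {x y z} → 0# ≤ z → x ≤ y → x * z ≤ y * z
  *-monoˡ-≤-nonNeg {x} {y} {z} 0≤z x≤y =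
    0≤y-x⇒x≤y (≤-respʳ ([y-z]x≈yx-zx z y x) (*-nonneg (x≤y⇒0≤y-x x≤y) 0≤z))

  0≤1 : 0# ≤ 1#
  0≤1 with total 0# 1#
  ... | inj₁ 0≤1 = 0≤1
  ... | inj₂ 1≤0 = ⊥-elim (0≉1 (antisym (≤-respʳ -1*-1≈1 (*-nonneg 0≤-1 0≤-1)) 1≤0))
    where
    0≤-1 : 0# ≤ - 1#
    0≤-1 = x≤0⇒0≤-x 1≤0
    -1*-1≈1 : - 1# * - 1# ≈ 1#
    -1*-1≈1 = trans (-1*x≈-x (- 1#)) (-‿involutive 1#)

  0≰-1 : ¬ (0# ≤ - 1#)
  0≰-1 0≤-1 = 0≉1 (antisym 0≤1 (0≤-x⇒x≤0 0≤-1))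

  0<x⇒0≤x⁻¹ : ∀ {x} (p : 0# < x) → 0# ≤ inv x (pos⇒≉0 p)
  0<x⇒0≤x⁻¹ {x} p with total 0# (inv x (pos⇒≉0 p))
  ... | inj₁ 0≤x⁻¹ = 0≤x⁻¹
  ... | inj₂ x⁻¹≤0 = ⊥-elim (0≰-1 (≤-respʳ x*-x⁻¹≈-1 (*-nonneg (proj₁ p) (x≤0⇒0≤-x x⁻¹≤0))))
    where
    x*-x⁻¹≈-1 : x * - inv x (pos⇒≉0 p) ≈ - 1#
    x*-x⁻¹≈-1 = trans (sym (-‿distribʳ-* x _)) (-‿cong (inverse x (pos⇒≉0 p)))

  -- Bridge to the library's exponentiation, which recurses through *-rawMonoid.
  ^≈^ᵉ : ∀ x k → x ^ k ≈ x ^ᵉ k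
  ^≈^ᵉ x zero    = refl
  ^≈^ᵉ x (suc k) = *-congˡ (^≈^ᵉ x k)

  ^-cong : ∀ {x y} k → x ≈ y → x ^ k ≈ y ^ k
  ^-cong {x} {y} k x≈y = trans (^≈^ᵉ x k) (trans (^-congˡ k x≈y) (sym (^≈^ᵉ y k)))

  ^-distribʳ-* : ∀ x y k → (x * y) ^ k ≈ x ^ k * y ^ k
  ^-distribʳ-* x y k = begin
    (x * y) ^ k      ≈⟨ ^≈^ᵉ (x * y) k ⟩
    (x * y) ^ᵉ k     ≈⟨ ^-distrib-* x y k ⟩
    x ^ᵉ k * y ^ᵉ k  ≈⟨ *-cong (^≈^ᵉ x k) (^≈^ᵉ y k) ⟨
    x ^ k * y ^ k    ∎

  ^-nonNeg : ∀ {r} k → 0# ≤ r → 0# ≤ r ^ k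
  ^-nonNeg zero    0≤r = 0≤1
  ^-nonNeg (suc k) 0≤r = *-nonneg 0≤r (^-nonNeg k 0≤r)

  ^-antitone : ∀ {r} {t k} → 0# ≤ r → r ≤ 1# → t ℕ.≤ k → r ^ k ≤ r ^ t
  ^-antitone {r} {t} 0≤r r≤1 t≤k with ℕ.≤⇒≤′ t≤k
  ... | ℕ.≤′-refl         = ≤-reflexive refl
  ... | ℕ.≤′-step {k} t≤′k =
    ≤-trans (≤-respʳ (*-identityˡ (r ^ k)) (*-monoˡ-≤-nonNeg (^-nonNeg k 0≤r) r≤1))
            (^-antitone 0≤r r≤1 (ℕ.≤′⇒≤ t≤′k))

  foldr-+-≤-* : ∀ {a} {A : Set a} (f g : A → Carrier) (s : Carrier) (xs : List A) →
    All (λ x → f x ≤ s * g x) xs →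
    foldr (λ x acc → f x + acc) 0# xs ≤ s * foldr (λ x acc → g x + acc) 0# xs
  foldr-+-≤-* f g s []       []           = ≤-reflexive (sym (zeroʳ s))
  foldr-+-≤-* f g s (x ∷ xs) (fx≤sgx ∷ h) =
    ≤-respʳ (sym (distribˡ s _ _)) (+-mono-≤₂ fx≤sgx (foldr-+-≤-* f g s xs h))

  μ^-k≤[λ/μ]^t*λ^-k : ∀ {λ' μ} (0<λ : 0# < λ') (λ≤μ : λ' ≤ μ) {t k} → t ℕ.≤ k →
    μ ^- k [ <-≤-pos 0<λ λ≤μ ] ≤ (λ' / μ [ <-≤-pos 0<λ λ≤μ ]) ^ t * λ' ^- k [ 0<λ ]
  μ^-k≤[λ/μ]^t*λ^-k {λ'} {μ} 0<λ λ≤μ {t} {k} t≤k =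
    ≤-respˡ r^k*λ⁻ᵏ≈μ⁻ᵏ (*-monoˡ-≤-nonNeg (^-nonNeg k (0<x⇒0≤x⁻¹ 0<λ)) (^-antitone 0≤r r≤1 t≤k))
    where
    0<μ : 0# < μ
    0<μ = <-≤-pos 0<λ λ≤μ
    λ⁻¹ μ⁻¹ r : Carrier
    λ⁻¹ = inv λ' (pos⇒≉0 0<λ)
    μ⁻¹ = inv μ (pos⇒≉0 0<μ)
    r = λ' / μ [ 0<μ ]

    0≤r : 0# ≤ r
    0≤r = *-nonneg (proj₁ 0<λ) (0<x⇒0≤x⁻¹ 0<μ)

    r≤1 : r ≤ 1#
    r≤1 = ≤-respʳ (inverse μ (pos⇒≉0 0<μ)) (*-monoˡ-≤-nonNeg (0<x⇒0≤x⁻¹ 0<μ) λ≤μ)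

    r*λ⁻¹≈μ⁻¹ : r * λ⁻¹ ≈ μ⁻¹
    r*λ⁻¹≈μ⁻¹ = begin
      λ' * μ⁻¹ * λ⁻¹    ≈⟨ *-congʳ (*-comm λ' μ⁻¹) ⟩
      μ⁻¹ * λ' * λ⁻¹    ≈⟨ *-assoc μ⁻¹ λ' λ⁻¹ ⟩
      μ⁻¹ * (λ' * λ⁻¹)  ≈⟨ *-congˡ (inverse λ' (pos⇒≉0 0<λ)) ⟩
      μ⁻¹ * 1#          ≈⟨ *-identityʳ μ⁻¹ ⟩
      μ⁻¹               ∎

    r^k*λ⁻ᵏ≈μ⁻ᵏ : r ^ k * λ⁻¹ ^ k ≈ μ⁻¹ ^ k
    r^k*λ⁻ᵏ≈μ⁻ᵏ = trans (sym (^-distribʳ-* r λ⁻¹ k)) (^-cong k r*λ⁻¹≈μ⁻¹)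

𝒞-size≥τ : ∀ {m} (n : ℕ) (ℱ : List (Subset m)) {t} → IsTau ℱ t → All (λ C → t ℕ.≤ ∣ C ∣) (𝒞 n ℱ)
𝒞-size≥τ {m} n ℱ (_ , τ≤cover) =
  -- allSubsets also takes the (unused) implicit m of Defs' anonymous module.
  All.map (λ (minimal , _) → τ≤cover _ (proj₁ minimal))
    (all-filter (λ C → minimalCover? ℱ C ×-dec (∣ C ∣ ℕ.≤? n)) (allSubsets {m} m))

mainTheorem3 : ∀ {c ℓ₁ ℓ₂} (K : OrderedField c ℓ₁ ℓ₂) (n : ℕ) → NonZero n →
    ∀ (m : ℕ) (ℱ : List (Subset m)) (t : ℕ) → IsTau ℱ t →
    (λ' μ : OrderedField.Carrier K) (0<λ : OrderedField._<_ K (OrderedField.0# K) λ') →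
    (λ≤μ : OrderedField._≤_ K λ' μ) →
    OrderedField._≤_ K
      (cλ K n ℱ μ (OrderedField.<-≤-pos K 0<λ λ≤μ))
      (OrderedField._*_ K
        (OrderedField._^_ K (OrderedField._/_[_] K λ' μ (OrderedField.<-≤-pos K 0<λ λ≤μ)) t)
        (cλ K n ℱ λ' 0<λ))
mainTheorem3 K n _ m ℱ t isτ λ' μ 0<λ λ≤μ =
  foldr-+-≤-* (λ C → μ ^- ∣ C ∣ [ 0<μ ]) (λ C → λ' ^- ∣ C ∣ [ 0<λ ]) ((λ' / μ [ 0<μ ]) ^ t) (𝒞 n ℱ)
    (All.map (μ^-k≤[λ/μ]^t*λ^-k 0<λ λ≤μ) (𝒞-size≥τ n ℱ isτ))
  where
  open OrderedField K
  open OrderedFieldProperties K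
  0<μ : 0# < μ
  0<μ = <-≤-pos 0<λ λ≤μ
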